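{- If $G$ is a split graph or a cograph with a perfect matching, then $f(G)\geq \frac{\delta(G)-1}{2}$. Moreover, the bound is tight: there exist split graphs and cographs with a perfect matching (of every even order $2n$ and every minimum degree $2k+1$, $0\le k\le n-1$) attaining $f(G)=\frac{\delta(G)-1}{2}$.
   Context: All graphs are finite and simple. For a graph $G$ with a perfect matching $M$, a subset $S\subseteq M$ is a forcing set of $M$ if $S$ is contained in no perfect matching of $G$ other than $M$. $f(G,M)$ is the minimum size of a forcing set of $M$, and $f(G)=\min_M f(G,M)$ over all perfect matchings $M$. $\delta(G)$ is the minimum degree. A graph is split if its vertex set can be partitioned into a clique and an independent set. A cograph is a graph that is either a single vertex or is obtained as the disjoint union or the join of two cographs, where the join of $G$ and $H$ is their disjoint union together with all edges between $V(G)$ and $V(H)$. -}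

module Defs where

open import Data.Nat using (ℕ; zero; suc; _+_; _*_; _⊓_; ⌊_/2⌋)
open import Data.Bool using (Bool; true; false; if_then_else_)
open import Data.Fin using (Fin; zero; suc; _↑ˡ_; _↑ʳ_; splitAt)
open import Data.Sum using (_⊎_; inj₁; inj₂)
open import Data.Product using (Σ; _×_; _,_; ∃)
open import Relation.Binary.PropositionalEquality using (_≡_; _≢_)
open import Function.Bundles using (_↔_; Inverse)

record Graph (n : ℕ) : Set where
  field
    adj    : Fin n → Fin n → Bool
    sym    : ∀ u v → adj u v ≡ adj v u
    irrefl : ∀ v → adj v v ≡ false
open Graph public

countTrue : ∀ {n} → (Fin n → Bool) → ℕ
countTrue {zero}  p = 0
countTrue {suc n} p = (if p zero then 1 else 0) + countTrue (λ i → p (suc i))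

-- minimum of f over Fin n (convention: 0 for the empty vertex set)
minOver : ∀ {n} → (Fin n → ℕ) → ℕ
minOver {zero}        f = 0
minOver {suc zero}    f = f zero
minOver {suc (suc n)} f = f zero ⊓ minOver (λ i → f (suc i))

degree : ∀ {n} → Graph n → Fin n → ℕ
degree G v = countTrue (adj G v)

δ : ∀ {n} → Graph n → ℕ
δ G = minOver (degree G)

-- A perfect matching M, represented by its partner map: m v is the vertex
-- matched to v.  M's edge set is { {v, m v} }.
record PerfectMatching {n : ℕ} (G : Graph n) : Set where
  field
    partner    : Fin n → Fin n
    involutive : ∀ v → partner (partner v) ≡ v
    noFix      : ∀ v → partner v ≢ v
    isEdge     : ∀ v → adj G v (partner v) ≡ true
open PerfectMatching public

-- Two perfect matchings are the same iff they have the same edge set,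
-- i.e. the same partner map.
SameMatching : ∀ {n} {G : Graph n} → PerfectMatching G → PerfectMatching G → Set
SameMatching M M' = ∀ v → partner M v ≡ partner M' v

-- A subset S ⊆ M of edges of M, represented by the set of vertices covered
-- by the edges of S (closed under the partner map).
record EdgeSubset {n : ℕ} {G : Graph n} (M : PerfectMatching G) : Set where
  field
    covered : Fin n → Bool
    closed  : ∀ v → covered (partner M v) ≡ covered v
open EdgeSubset public

-- number of edges in S (each edge covers exactly two vertices)
size : ∀ {n} {G : Graph n} {M : PerfectMatching G} → EdgeSubset M → ℕ
size S = ⌊ countTrue (covered S) /2⌋

_∈S_ : ∀ {n} {G : Graph n} {M : PerfectMatching G} → Fin n → EdgeSubset M → Set
v ∈S S = covered S v ≡ true

IsForcing : ∀ {n} {G : Graph n} (M : PerfectMatching G) → EdgeSubset M → Set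
IsForcing {G = G} M S =
  (M' : PerfectMatching G) → (∀ v → v ∈S S → partner M' v ≡ partner M v) →
  SameMatching M M'

-- f(G) ≥ k : every forcing set of every perfect matching has size ≥ k
-- f(G) ≤ k : some perfect matching has a forcing set of size ≤ k
open import Data.Nat using (_≤_)
fAtLeast : ∀ {n} → Graph n → ℕ → Set
fAtLeast G k = (M : PerfectMatching G) (S : EdgeSubset M) → IsForcing M S → k ≤ size S

fAtMost : ∀ {n} → Graph n → ℕ → Set
fAtMost G k = Σ (PerfectMatching G) λ M → Σ (EdgeSubset M) λ S → IsForcing M S × size S ≤ k

fEquals : ∀ {n} → Graph n → ℕ → Set
fEquals G k = fAtLeast G k × fAtMost G k

-- Split graph: vertex set partitions into a clique (true) and an
-- independent set (false).
IsSplit : ∀ {n} → Graph n → Set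
IsSplit {n} G = Σ (Fin n → Bool) λ c →
  (∀ u v → c u ≡ true → c v ≡ true → u ≢ v → adj G u v ≡ true) ×
  (∀ u v → c u ≡ false → c v ≡ false → adj G u v ≡ false)

data CoExpr : ℕ → Set where
  vertex : CoExpr 1
  union  : ∀ {m k} → CoExpr m → CoExpr k → CoExpr (m + k)
  join   : ∀ {m k} → CoExpr m → CoExpr k → CoExpr (m + k)

-- adjacency of the graph denoted by an expression (vertices of the left part
-- are the first m, of the right part the last k)
coAdj : ∀ {n} → CoExpr n → Fin n → Fin n → Bool
coAdj vertex u v = false
coAdj (union {m} {k} e₁ e₂) u v with splitAt m u | splitAt m v
... | inj₁ a | inj₁ b = coAdj e₁ a b
... | inj₂ a | inj₂ b = coAdj e₂ a b
... | inj₁ _ | inj₂ _ = false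
... | inj₂ _ | inj₁ _ = false
coAdj (join {m} {k} e₁ e₂) u v with splitAt m u | splitAt m v
... | inj₁ a | inj₁ b = coAdj e₁ a b
... | inj₂ a | inj₂ b = coAdj e₂ a b
... | inj₁ _ | inj₂ _ = true
... | inj₂ _ | inj₁ _ = true

IsCograph : ∀ {n} → Graph n → Set
IsCograph {n} G = Σ (CoExpr n) λ e → Σ (Fin n ↔ Fin n) λ σ →
  ∀ u v → adj G u v ≡ coAdj e (Inverse.to σ u) (Inverse.to σ v)

-- Let S force M. A vertex with no neighbour outside V(S) other than its partner has degree at
-- most |V(S)| + 1 = 2|S| + 1. Otherwise G - V(S) has minimum degree 2, and in a split graph or a
-- cograph this yields an M-alternating cycle avoiding V(S): in a split graph by following
-- x ↦ mate (other x) through the uncovered independent vertices, in a cograph, by induction on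
-- its expression, even a cycle of length 4. Switching M along the cycle gives a second perfect
-- matching containing S.
-- The bound is attained by the threshold graph built from an edge by adding j pendant pairs and
-- then k pairs of dominating vertices: covering the k top pairs forces the unique perfect
-- matching below them.
module Submission where

open import Defs hiding (sym)
open import Data.Nat.Properties
open import Algebra.Properties.CommutativeMonoid.Sum +-0-commutativeMonoid using (sum; sum-permute)
open import Data.Bool using (Bool; true; false; not; _∧_; if_then_else_)
import Data.Bool.Properties as Bool
open import Data.Empty using (⊥; ⊥-elim)
open import Data.Fin using (Fin; zero; suc; toℕ; _↑ˡ_; _↑ʳ_; splitAt)
import Data.Fin.Properties as Fin
import Data.Fin.Permutation as Perm
open import Data.Fin.Permutation using (Permutation′; _⟨$⟩ʳ_; _⟨$⟩ˡ_; permutation; inverseˡ; inverseʳ)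
open import Data.Nat using (ℕ; zero; suc; _+_; _*_; _∸_; _≤_; _<_; z≤n; s≤s; ⌊_/2⌋)
open import Data.Product using (Σ; ∃; ∃₂; _×_; _,_; proj₁; proj₂)
open import Data.Sum using (_⊎_; inj₁; inj₂; [_,_]′)
open import Data.Vec.Functional using (_∷_)
open import Function using (_∘_)
open import Relation.Binary.PropositionalEquality
open import Relation.Nullary using (Dec; yes; no; ¬_; contradiction)
open import Relation.Nullary.Decidable using (⌊_⌋; _×-dec_; _⊎-dec_; ¬?; decidable-stable)
open import Relation.Unary using (Decidable)

-- Counting

indicator : Bool → ℕ
indicator b = if b then 1 else 0

countTrue-cong : ∀ {n} {p q : Fin n → Bool} → (∀ i → p i ≡ q i) → countTrue p ≡ countTrue q
countTrue-cong {zero}  p≡q = refl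
countTrue-cong {suc n} p≡q = cong₂ _+_ (cong indicator (p≡q zero)) (countTrue-cong (p≡q ∘ suc))

countTrue≡sum : ∀ {n} (p : Fin n → Bool) → countTrue p ≡ sum (indicator ∘ p)
countTrue≡sum {zero}  p = refl
countTrue≡sum {suc n} p = cong (indicator (p zero) +_) (countTrue≡sum (p ∘ suc))

countTrue-permute : ∀ {n} (p : Fin n → Bool) (π : Permutation′ n) →
                    countTrue (p ∘ (π ⟨$⟩ʳ_)) ≡ countTrue p
countTrue-permute p π = begin
  countTrue (p ∘ (π ⟨$⟩ʳ_))      ≡⟨ countTrue≡sum (p ∘ (π ⟨$⟩ʳ_)) ⟩
  sum (indicator ∘ p ∘ (π ⟨$⟩ʳ_)) ≡⟨ sum-permute (indicator ∘ p) π ⟨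
  sum (indicator ∘ p)            ≡⟨ countTrue≡sum p ⟨
  countTrue p                    ∎
  where open ≡-Reasoning

countTrue-none : ∀ {n} (p : Fin n → Bool) → (∀ i → p i ≡ false) → countTrue p ≡ 0
countTrue-none {zero}  p none = refl
countTrue-none {suc n} p none rewrite none zero = countTrue-none (p ∘ suc) (none ∘ suc)

countTrue-all : ∀ n → countTrue {n} (λ _ → true) ≡ n
countTrue-all zero    = refl
countTrue-all (suc n) = cong suc (countTrue-all n)

countTrue-pos : ∀ {n} (p : Fin n → Bool) {a} → p a ≡ true → 1 ≤ countTrue p
countTrue-pos p {zero}  pa rewrite pa = s≤s z≤n
countTrue-pos p {suc a} pa = ≤-trans (countTrue-pos (p ∘ suc) pa) (m≤n+m _ _)

countTrue-mono : ∀ {n} (p q : Fin n → Bool) → (∀ i → p i ≡ true → q i ≡ true) →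
                 countTrue p ≤ countTrue q
countTrue-mono {zero}  p q p⊆q = z≤n
countTrue-mono {suc n} p q p⊆q with p zero in p₀ | q zero in q₀
... | false | _     = ≤-trans (countTrue-mono (p ∘ suc) (q ∘ suc) (p⊆q ∘ suc)) (m≤n+m _ _)
... | true  | true  = s≤s (countTrue-mono (p ∘ suc) (q ∘ suc) (p⊆q ∘ suc))
... | true  | false with () ← trans (sym (p⊆q zero p₀)) q₀

countTrue-split : ∀ {n} (p q : Fin n → Bool) →
  countTrue p ≡ countTrue (λ i → p i ∧ q i) + countTrue (λ i → p i ∧ not (q i))
countTrue-split {zero}  p q = refl
countTrue-split {suc n} p q with p zero | q zero | countTrue-split (p ∘ suc) (q ∘ suc)
... | true  | true  | ih = cong suc ih
... | true  | false | ih = trans (cong suc ih) (sym (+-suc _ _))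
... | false | _     | ih = ih

countTrue-≤1 : ∀ {n} (p : Fin n → Bool) (a : Fin n) → (∀ i → p i ≡ true → i ≡ a) →
               countTrue p ≤ 1
countTrue-≤1 {suc n} p zero    only = +-mono-≤ indicator≤1 (≤-reflexive tail≡0)
  where
  indicator≤1 : indicator (p zero) ≤ 1
  indicator≤1 with p zero
  ... | true  = ≤-refl
  ... | false = z≤n
  tail≡0 : countTrue (p ∘ suc) ≡ 0
  tail≡0 = countTrue-none (p ∘ suc) (λ i → Bool.¬-not (λ pᵢ → contradiction (only (suc i) pᵢ) λ ()))
countTrue-≤1 {suc n} p (suc a) only rewrite Bool.¬-not {p zero} (λ p₀ → contradiction (only zero p₀) λ ()) =
  countTrue-≤1 (p ∘ suc) a (λ i pᵢ → Fin.suc-injective (only (suc i) pᵢ))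

precedes : ∀ {n} → Fin n → Fin n → Bool
precedes u v = ⌊ u Fin.<? v ⌋

precedes-flip : ∀ {n} (u v : Fin n) → u ≢ v → not (precedes u v) ≡ precedes v u
precedes-flip u v u≢v with u Fin.<? v | v Fin.<? u
... | yes u<v | yes v<u = contradiction v<u (Fin.<-asym u<v)
... | yes _   | no _    = refl
... | no _    | yes _   = refl
... | no u≮v  | no v≮u = contradiction (Fin.≤-antisym (≮⇒≥ v≮u) (≮⇒≥ u≮v)) u≢v

-- Each orbit {v, m v} is counted once through its smaller and once through its larger element.
countTrue-involution : ∀ {n} (m : Fin n → Fin n) (p : Fin n → Bool) →
  (∀ v → m (m v) ≡ v) → (∀ v → m v ≢ v) → (∀ v → p (m v) ≡ p v) →
  ∃ λ k → countTrue p ≡ k + k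
countTrue-involution {n} m p m-inv m-free p-closed = k , (begin
  countTrue p                                                ≡⟨ countTrue-split p lower ⟩
  k + countTrue (λ v → p v ∧ not (lower v))                  ≡⟨ cong (k +_) (countTrue-cong upper≡lower∘m) ⟩
  k + countTrue ((λ v → p v ∧ lower v) ∘ (π ⟨$⟩ʳ_))           ≡⟨ cong (k +_) (countTrue-permute _ π) ⟩
  k + k                                                      ∎)
  where
  open ≡-Reasoning
  lower : Fin n → Bool
  lower v = precedes v (m v)
  k = countTrue (λ v → p v ∧ lower v)
  π : Permutation′ n
  π = permutation m m m-inv m-inv
  upper≡lower∘m : ∀ v → p v ∧ not (lower v) ≡ p (m v) ∧ lower (m v)
  upper≡lower∘m v rewrite p-closed v | m-inv v = cong (p v ∧_) (precedes-flip v (m v) (m-free v ∘ sym))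

countTrue-covered : ∀ {n} {G : Graph n} {M : PerfectMatching G} (S : EdgeSubset M) →
                    countTrue (covered S) ≡ 2 * size S
countTrue-covered {M = M} S with countTrue-involution (partner M) (covered S) (involutive M) (noFix M) (closed S)
... | k , count≡k+k = begin
  countTrue (covered S) ≡⟨ count≡k+k ⟩
  k + k                 ≡⟨ cong (k +_) (+-identityʳ k) ⟨
  2 * k                 ≡⟨ cong (2 *_) (n≡⌊n+n/2⌋ k) ⟩
  2 * ⌊ k + k /2⌋       ≡⟨ cong (λ c → 2 * ⌊ c /2⌋) count≡k+k ⟨
  2 * size S            ∎
  where open ≡-Reasoning

minOver-≤ : ∀ {n} (f : Fin n → ℕ) v → minOver f ≤ f v
minOver-≤ {suc zero}    f zero    = ≤-refl
minOver-≤ {suc (suc n)} f zero    = m⊓n≤m _ _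
minOver-≤ {suc (suc n)} f (suc v) = ≤-trans (m⊓n≤n _ _) (minOver-≤ (f ∘ suc) v)

minOver-glb : ∀ {n} (f : Fin n → ℕ) {d} → Fin n → (∀ v → d ≤ f v) → d ≤ minOver f
minOver-glb {suc zero}    f _ d≤f = d≤f zero
minOver-glb {suc (suc n)} f _ d≤f = ⊓-glb (d≤f zero) (minOver-glb (f ∘ suc) zero (d≤f ∘ suc))

δ-attained : ∀ {n} (G : Graph n) {d} v → degree G v ≡ d → (∀ w → d ≤ degree G w) → δ G ≡ d
δ-attained G v deg≡d d≤deg =
  ≤-antisym (≤-trans (minOver-≤ (degree G) v) (≤-reflexive deg≡d)) (minOver-glb (degree G) v d≤deg)

-- Alternating cycles

record SubMatching {N} (R : Fin N → Fin N → Bool) : Set where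
  field
    inside          : Fin N → Bool
    mate            : Fin N → Fin N
    inside-mate     : ∀ {v} → inside v ≡ true → inside (mate v) ≡ true
    mate-involutive : ∀ {v} → inside v ≡ true → mate (mate v) ≡ v
    adj-mate        : ∀ {v} → inside v ≡ true → R v (mate v) ≡ true

  mate-injective : ∀ {u v} → inside u ≡ true → inside v ≡ true → mate u ≡ mate v → u ≡ v
  mate-injective {u} {v} u∈ v∈ mu≡mv =
    trans (sym (mate-involutive u∈)) (trans (cong mate mu≡mv) (mate-involutive v∈))

module _ {N} {R : Fin N → Fin N → Bool} (D : SubMatching R) where
  open SubMatching D

  -- the paper's hypothesis that G - V(S) has minimum degree 2, with a chosen witness
  record SecondNeighbour : Set where
    field
      other        : Fin N → Fin N
      inside-other : ∀ {v} → inside v ≡ true → inside (other v) ≡ true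
      adj-other    : ∀ {v} → inside v ≡ true → R v (other v) ≡ true
      other≢mate   : ∀ {v} → inside v ≡ true → other v ≢ mate v

  record AlternatingSquare : Set where
    field
      u w       : Fin N
      inside-u  : inside u ≡ true
      inside-w  : inside w ≡ true
      w≢u       : w ≢ u
      w≢mate-u  : w ≢ mate u
      adj-u-w   : R u w ≡ true
      adj-mates : R (mate u) (mate w) ≡ true

record PermutedSet {n} (g : Fin n → Fin n) : Set₁ where
  field
    member       : Fin n → Set
    member?      : Decidable member
    g-member     : ∀ {x} → member x → member (g x)
    g⁻¹          : Fin n → Fin n
    g⁻¹-member   : ∀ {x} → member x → member (g⁻¹ x)
    g⁻¹-g        : ∀ {x} → member x → g⁻¹ (g x) ≡ x
    g-g⁻¹        : ∀ {x} → member x → g (g⁻¹ x) ≡ x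
    start        : Fin n
    start-member : member start

-- Each member x continues the cycle by the non-matching edge x — mate (next x) and the matching
-- edge mate (next x) — next x; trading the matching edges for the others gives a new matching.
record AlternatingCycle {N} {R : Fin N → Fin N → Bool} (D : SubMatching R) : Set₁ where
  open SubMatching D
  field
    next     : Fin N → Fin N
    permuted : PermutedSet next
  open PermutedSet permuted
  field
    member-inside : ∀ {x} → member x → inside x ≡ true
    mate-∉        : ∀ {x} → member x → ¬ member (mate x)
    adj-next      : ∀ {x} → member x → R x (mate (next x)) ≡ true
    next-moves    : next start ≢ start

partner-injective : ∀ {n} {G : Graph n} (M : PerfectMatching G) {u v} → partner M u ≡ partner M v → u ≡ v
partner-injective M {u} {v} mu≡mv =
  trans (sym (involutive M u)) (trans (cong (partner M) mu≡mv) (involutive M v))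

uncovered : ∀ {n} {G : Graph n} (M : PerfectMatching G) → EdgeSubset M → SubMatching (adj G)
uncovered M S = record
  { inside          = not ∘ covered S
  ; mate            = partner M
  ; inside-mate     = λ {v} v∈ → trans (cong not (closed S v)) v∈
  ; mate-involutive = λ {v} _ → involutive M v
  ; adj-mate        = λ {v} _ → isEdge M v
  }

module Rotation {n} {G : Graph n} (M : PerfectMatching G) (S : EdgeSubset M)
  (Z : AlternatingCycle (uncovered M S)) where
  open AlternatingCycle Z
  open PermutedSet permuted
  m = partner M

  m-member : ∀ {v} → member v → member (m (m v))
  m-member {v} = subst member (sym (involutive M v))

  rotated : Fin n → Fin n
  rotated v with member? v | member? (m v)
  ... | yes _ | _     = m (next v)
  ... | no _  | yes _ = g⁻¹ (m v)
  ... | no _  | no _  = m v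

  rotated-on : ∀ {v} → member v → rotated v ≡ m (next v)
  rotated-on {v} v∈ with member? v
  ... | yes _  = refl
  ... | no v∉ = contradiction v∈ v∉

  rotated-before : ∀ {v} → ¬ member v → member (m v) → rotated v ≡ g⁻¹ (m v)
  rotated-before {v} v∉ mv∈ with member? v | member? (m v)
  ... | yes v∈ | _       = contradiction v∈ v∉
  ... | no _   | yes _   = refl
  ... | no _   | no mv∉ = contradiction mv∈ mv∉

  rotated-off : ∀ {v} → ¬ member v → ¬ member (m v) → rotated v ≡ m v
  rotated-off {v} v∉ mv∉ with member? v | member? (m v)
  ... | yes v∈ | _      = contradiction v∈ v∉
  ... | no _   | yes mv∈ = contradiction mv∈ mv∉
  ... | no _   | no _   = refl

  rotated-involutive : ∀ v → rotated (rotated v) ≡ v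
  rotated-involutive v = by-cases (member? v) (member? (m v))
    where
    open ≡-Reasoning
    by-cases : Dec (member v) → Dec (member (m v)) → rotated (rotated v) ≡ v
    by-cases (yes v∈) _ = begin
      rotated (rotated v)  ≡⟨ cong rotated (rotated-on v∈) ⟩
      rotated (m (next v)) ≡⟨ rotated-before (mate-∉ (g-member v∈)) (m-member (g-member v∈)) ⟩
      g⁻¹ (m (m (next v))) ≡⟨ cong g⁻¹ (involutive M (next v)) ⟩
      g⁻¹ (next v)         ≡⟨ g⁻¹-g v∈ ⟩
      v                    ∎
    by-cases (no v∉) (yes mv∈) = begin
      rotated (rotated v)  ≡⟨ cong rotated (rotated-before v∉ mv∈) ⟩
      rotated (g⁻¹ (m v))  ≡⟨ rotated-on (g⁻¹-member mv∈) ⟩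
      m (next (g⁻¹ (m v))) ≡⟨ cong m (g-g⁻¹ mv∈) ⟩
      m (m v)              ≡⟨ involutive M v ⟩
      v                    ∎
    by-cases (no v∉) (no mv∉) = begin
      rotated (rotated v)  ≡⟨ cong rotated (rotated-off v∉ mv∉) ⟩
      rotated (m v)        ≡⟨ rotated-off mv∉ (v∉ ∘ subst member (involutive M v)) ⟩
      m (m v)              ≡⟨ involutive M v ⟩
      v                    ∎

  rotated-noFix : ∀ v → rotated v ≢ v
  rotated-noFix v = by-cases (member? v) (member? (m v))
    where
    by-cases : Dec (member v) → Dec (member (m v)) → rotated v ≢ v
    by-cases (yes v∈) _ fixed =
      mate-∉ (g-member v∈) (subst member (trans (sym fixed) (rotated-on v∈)) v∈)
    by-cases (no v∉) (yes mv∈) fixed =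
      v∉ (subst member (trans (sym (rotated-before v∉ mv∈)) fixed) (g⁻¹-member mv∈))
    by-cases (no v∉) (no mv∉) fixed = noFix M v (trans (sym (rotated-off v∉ mv∉)) fixed)

  back-edge : ∀ {v} → member (m v) → adj G v (g⁻¹ (m v)) ≡ true
  back-edge {v} mv∈ = begin
    adj G v x            ≡⟨ cong (λ y → adj G y x) (involutive M v) ⟨
    adj G (m (m v)) x    ≡⟨ cong (λ y → adj G (m y) x) (g-g⁻¹ mv∈) ⟨
    adj G (m (next x)) x ≡⟨ Graph.sym G (m (next x)) x ⟩
    adj G x (m (next x)) ≡⟨ adj-next (g⁻¹-member mv∈) ⟩
    true                 ∎
    where
    open ≡-Reasoning
    x = g⁻¹ (m v)

  rotated-isEdge : ∀ v → adj G v (rotated v) ≡ true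
  rotated-isEdge v = by-cases (member? v) (member? (m v))
    where
    edge-to : ∀ {y} → rotated v ≡ y → adj G v y ≡ true → adj G v (rotated v) ≡ true
    edge-to eq = subst (λ y → adj G v y ≡ true) (sym eq)
    by-cases : Dec (member v) → Dec (member (m v)) → adj G v (rotated v) ≡ true
    by-cases (yes v∈)  _          = edge-to (rotated-on v∈) (adj-next v∈)
    by-cases (no v∉)  (yes mv∈) = edge-to (rotated-before v∉ mv∈) (back-edge mv∈)
    by-cases (no v∉)  (no mv∉)  = edge-to (rotated-off v∉ mv∉) (isEdge M v)

  M′ : PerfectMatching G
  M′ = record
    { partner = rotated ; involutive = rotated-involutive ; noFix = rotated-noFix ; isEdge = rotated-isEdge }

  covered-∉ : ∀ {v} → v ∈S S → ¬ member v
  covered-∉ v∈S v∈ = contradiction (trans (sym (cong not v∈S)) (member-inside v∈)) λ ()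

  agrees-on-S : ∀ v → v ∈S S → partner M′ v ≡ m v
  agrees-on-S v v∈S = rotated-off (covered-∉ v∈S) (covered-∉ (trans (closed S v) v∈S))

alternatingCycle⇒¬forcing : ∀ {n} {G : Graph n} (M : PerfectMatching G) (S : EdgeSubset M) →
                             AlternatingCycle (uncovered M S) → ¬ IsForcing M S
alternatingCycle⇒¬forcing M S Z forcing = next-moves (sym (partner-injective M start-unmoved))
  where
  open AlternatingCycle Z
  open PermutedSet permuted
  open Rotation M S Z using (M′; agrees-on-S; rotated-on)
  start-unmoved : partner M start ≡ partner M (next start)
  start-unmoved = trans (forcing M′ agrees-on-S start) (rotated-on start-member)

module _ {n} (g : Fin n → Fin n) where
  open import Function.Endo.Propositional (Fin n) using (_^_; ^-homo)

  ^-+ : ∀ j k x → (g ^ (j + k)) x ≡ (g ^ j) ((g ^ k) x)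
  ^-+ j k x = cong-app (^-homo g j k) x

  ^-comm : ∀ j k x → (g ^ j) ((g ^ k) x) ≡ (g ^ k) ((g ^ j) x)
  ^-comm j k x = trans (sym (^-+ j k x)) (trans (cong (λ e → (g ^ e) x) (+-comm j k)) (^-+ k j x))

  ^-preserves : {X : Fin n → Set} → (∀ {x} → X x → X (g x)) → ∀ k {x} → X x → X ((g ^ k) x)
  ^-preserves g-X zero    x∈ = x∈
  ^-preserves {X} g-X (suc k) x∈ = g-X (^-preserves {X} g-X k x∈)

  -- pigeonhole on x, g x, …, gⁿ x
  eventually-periodic : ∀ x → ∃₂ λ i p → (g ^ suc p) ((g ^ i) x) ≡ (g ^ i) x
  eventually-periodic x with Fin.pigeonhole (n<1+n n) (λ k → (g ^ toℕ k) x)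
  ... | i , j , i<j , gⁱx≡gʲx with m≤n⇒∃[o]m+o≡n i<j
  ...   | p , i+1+p≡j = toℕ i , p , (begin
    (g ^ suc p) ((g ^ toℕ i) x) ≡⟨ ^-+ (suc p) (toℕ i) x ⟨
    (g ^ (suc p + toℕ i)) x     ≡⟨ cong (λ e → (g ^ suc e) x) (+-comm p (toℕ i)) ⟩
    (g ^ (suc (toℕ i) + p)) x   ≡⟨ cong (λ e → (g ^ e) x) i+1+p≡j ⟩
    (g ^ toℕ j) x               ≡⟨ gⁱx≡gʲx ⟨
    (g ^ toℕ i) x               ∎)
    where open ≡-Reasoning

  -- g permutes the points of X of period p + 1, with inverse g ^ p
  periodicPoints : {X : Fin n → Set} → Decidable X → (∀ {x} → X x → X (g x)) → ∀ {x₀} → X x₀ →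
                   Σ (PermutedSet g) λ P → ∀ {x} → PermutedSet.member P x → X x
  periodicPoints {X} X? g-X {x₀} x₀∈ with eventually-periodic x₀
  ... | i , p , periodic = record
    { member       = Periodic
    ; member?      = λ v → X? v ×-dec ((g ^ suc p) v Fin.≟ v)
    ; g-member     = λ {v} (v∈ , gᵖ⁺¹v≡v) → g-X v∈ , trans (^-comm (suc p) 1 v) (cong g gᵖ⁺¹v≡v)
    ; g⁻¹          = g ^ p
    ; g⁻¹-member   = λ {v} (v∈ , gᵖ⁺¹v≡v) →
                       ^-preserves {X} g-X p v∈ , trans (^-comm (suc p) p v) (cong (g ^ p) gᵖ⁺¹v≡v)
    ; g⁻¹-g        = λ {v} (_ , gᵖ⁺¹v≡v) → trans (^-comm p 1 v) gᵖ⁺¹v≡v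
    ; g-g⁻¹        = proj₂
    ; start        = (g ^ i) x₀
    ; start-member = ^-preserves {X} g-X i x₀∈ , periodic
    } , proj₁
    where
    Periodic : Fin n → Set
    Periodic v = X v × (g ^ suc p) v ≡ v

find : ∀ {n} {P : Fin n → Set} → Decidable P → ∃ P ⊎ (∀ v → ¬ P v)
find P? with Fin.any? P?
... | yes found = inj₁ found
... | no none   = inj₂ λ v Pv → none (v , Pv)

adj-≢ : ∀ {n} (G : Graph n) {u v} → adj G u v ≡ true → u ≢ v
adj-≢ G {u} uv refl = contradiction (trans (sym uv) (irrefl G u)) λ ()

module _ {n} (G : Graph n) (D : SubMatching (adj G)) where
  open SubMatching D

  mate-≢ : ∀ {v} → inside v ≡ true → mate v ≢ v
  mate-≢ v∈ = adj-≢ G (adj-mate v∈) ∘ sym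

  module SquareSwap (sq : AlternatingSquare D) where
    open AlternatingSquare sq

    w′ = mate w

    w′≢u : w′ ≢ u
    w′≢u w′≡u = w≢mate-u (trans (sym (mate-involutive inside-w)) (cong mate w′≡u))

    Member : Fin n → Set
    Member v = v ≡ u ⊎ v ≡ w′

    swap : Fin n → Fin n
    swap v with v Fin.≟ u
    ... | yes _ = w′
    ... | no _  = u

    swap-u : swap u ≡ w′
    swap-u with u Fin.≟ u
    ... | yes _   = refl
    ... | no u≢u = contradiction refl u≢u

    swap-w′ : swap w′ ≡ u
    swap-w′ with w′ Fin.≟ u
    ... | yes w′≡u = contradiction w′≡u w′≢u
    ... | no _      = refl

    swap-member : ∀ {x} → Member x → Member (swap x)
    swap-member (inj₁ refl) = inj₂ swap-u
    swap-member (inj₂ refl) = inj₁ swap-w′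

    swap-swap : ∀ {x} → Member x → swap (swap x) ≡ x
    swap-swap (inj₁ refl) = trans (cong swap swap-u) swap-w′
    swap-swap (inj₂ refl) = trans (cong swap swap-w′) swap-u

    swapped : PermutedSet swap
    swapped = record
      { member       = Member
      ; member?      = λ v → (v Fin.≟ u) ⊎-dec (v Fin.≟ w′)
      ; g-member     = swap-member
      ; g⁻¹          = swap
      ; g⁻¹-member   = swap-member
      ; g⁻¹-g        = swap-swap
      ; g-g⁻¹        = swap-swap
      ; start        = u
      ; start-member = inj₁ refl
      }

    member-inside : ∀ {x} → Member x → inside x ≡ true
    member-inside (inj₁ refl) = inside-u
    member-inside (inj₂ refl) = inside-mate inside-w

    mate-∉ : ∀ {x} → Member x → ¬ Member (mate x)
    mate-∉ (inj₁ refl) (inj₁ mu≡u)   = mate-≢ inside-u mu≡u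
    mate-∉ (inj₁ refl) (inj₂ mu≡w′)  = w≢u (sym (mate-injective inside-u inside-w mu≡w′))
    mate-∉ (inj₂ refl) (inj₁ mw′≡u)  = w≢u (trans (sym (mate-involutive inside-w)) mw′≡u)
    mate-∉ (inj₂ refl) (inj₂ mw′≡w′) = mate-≢ inside-w (trans (sym mw′≡w′) (mate-involutive inside-w))

    adj-swap : ∀ {x} → Member x → adj G x (mate (swap x)) ≡ true
    adj-swap (inj₁ refl) = subst (λ y → adj G u (mate y) ≡ true) (sym swap-u)
                             (subst (λ y → adj G u y ≡ true) (sym (mate-involutive inside-w)) adj-u-w)
    adj-swap (inj₂ refl) = subst (λ y → adj G w′ (mate y) ≡ true) (sym swap-w′)
                             (trans (Graph.sym G w′ (mate u)) adj-mates)

  square⇒cycle : AlternatingSquare D → AlternatingCycle D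
  square⇒cycle sq = record
    { next          = swap
    ; permuted      = swapped
    ; member-inside = member-inside
    ; mate-∉        = mate-∉
    ; adj-next      = adj-swap
    ; next-moves    = λ swap-u≡u → w′≢u (trans (sym swap-u) swap-u≡u)
    }
    where open SquareSwap sq

-- Split graphs

-- Either two clique vertices are matched to the ends of a non-matching edge (an alternating
-- square), or x ↦ mate (other x) never leaves the uncovered independent vertices.
module SplitCycle {n} (G : Graph n) (split : IsSplit G) (D : SubMatching (adj G)) (O : SecondNeighbour D) where
  open SubMatching D
  open SecondNeighbour O
  c = proj₁ split
  complete = proj₁ (proj₂ split)
  independent = proj₂ (proj₂ split)

  step : Fin n → Fin n
  step x = mate (other x)

  neighbour-in-clique : ∀ {v w} → c v ≡ false → adj G v w ≡ true → c w ≡ true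
  neighbour-in-clique {v} {w} cv≡false vw = Bool.¬-not (λ cw≡false →
    contradiction (trans (sym vw) (independent v w cv≡false cw≡false)) λ ())

  mate-in-clique : ∀ {x} → c x ≡ false → inside x ≡ true → c (mate x) ≡ true
  mate-in-clique cx x∈ = neighbour-in-clique cx (adj-mate x∈)

  adj-step : ∀ {x} → inside x ≡ true → adj G x (mate (step x)) ≡ true
  adj-step x∈ = subst (λ y → adj G _ y ≡ true) (sym (mate-involutive (inside-other x∈))) (adj-other x∈)

  step-moves : ∀ {x} → inside x ≡ true → step x ≢ x
  step-moves x∈ fixed = other≢mate x∈ (trans (sym (mate-involutive (inside-other x∈))) (cong mate fixed))

  clique-square : ∀ {u} → inside u ≡ true → c (mate u) ≡ true → c (step u) ≡ true → AlternatingSquare D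
  clique-square {u} u∈ c-mu c-mw = record
    { u = u ; w = other u ; inside-u = u∈ ; inside-w = inside-other u∈
    ; w≢u       = adj-≢ G (adj-other u∈) ∘ sym
    ; w≢mate-u  = other≢mate u∈
    ; adj-u-w   = adj-other u∈
    ; adj-mates = complete (mate u) (step u) c-mu c-mw
                    (adj-≢ G (adj-other u∈) ∘ mate-injective u∈ (inside-other u∈))
    }

  Independent : Fin n → Set
  Independent v = inside v ≡ true × c v ≡ false

  independent? : Decidable Independent
  independent? v = (inside v Bool.≟ true) ×-dec (c v Bool.≟ false)

  module _ (closed : ∀ {x} → Independent x → c (step x) ≡ false) {x₁} (x₁∈ : Independent x₁) where
    step-independent : ∀ {x} → Independent x → Independent (step x)
    step-independent (x∈ , cx) = inside-mate (inside-other x∈) , closed (x∈ , cx)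

    P = proj₁ (periodicPoints step independent? step-independent x₁∈)
    P⊆I = proj₂ (periodicPoints step independent? step-independent x₁∈)

    independent-cycle : AlternatingCycle D
    independent-cycle = record
      { next          = step
      ; permuted      = P
      ; member-inside = proj₁ ∘ P⊆I
      ; mate-∉        = λ x∈P mx∈P →
          contradiction (trans (sym (mate-in-clique (proj₂ (P⊆I x∈P)) (proj₁ (P⊆I x∈P))))
                               (proj₂ (P⊆I mx∈P))) λ ()
      ; adj-next      = adj-step ∘ proj₁ ∘ P⊆I
      ; next-moves    = step-moves (proj₁ (P⊆I (PermutedSet.start-member P)))
      }

  alternatingCycle : ∀ {x₀} → inside x₀ ≡ true → AlternatingCycle D
  alternatingCycle x₀∈ with find independent?
  ... | inj₂ none = square⇒cycle G D (clique-square x₀∈ (in-clique (inside-mate x₀∈))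
                                        (in-clique (inside-mate (inside-other x₀∈))))
    where
    in-clique : ∀ {v} → inside v ≡ true → c v ≡ true
    in-clique v∈ = Bool.¬-not (λ cv≡false → none _ (v∈ , cv≡false))
  ... | inj₁ (_ , x₁∈) with find (λ x → independent? x ×-dec (c (step x) Bool.≟ true))
  ...   | inj₁ (x , (x∈ , cx≡false) , c-step) =
          square⇒cycle G D (clique-square x∈ (mate-in-clique cx≡false x∈) c-step)
  ...   | inj₂ none = independent-cycle (λ x∈I → Bool.¬-not (λ c-step → none _ (x∈I , c-step))) x₁∈

-- Cographs

≡-or-≡not : ∀ x b → x ≡ b ⊎ x ≡ not b
≡-or-≡not x b with x Bool.≟ b
... | yes x≡b = inj₁ x≡b
... | no x≢b  = inj₂ (Bool.¬-not x≢b)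

module JoinSides {N} {R : Fin N → Fin N → Bool} (R-irrefl : ∀ v → R v v ≡ false)
  (D : SubMatching R) (O : SecondNeighbour D)
  (s : Fin N → Bool) (cross : ∀ {u w} → s u ≢ s w → R u w ≡ true) where
  open SubMatching D
  open SecondNeighbour O

  Pair : Bool → Bool → Fin N → Set
  Pair b b′ v = inside v ≡ true × s v ≡ b × s (mate v) ≡ b′

  pair? : ∀ b b′ → Decidable (Pair b b′)
  pair? b b′ v = (inside v Bool.≟ true) ×-dec (s v Bool.≟ b) ×-dec (s (mate v) Bool.≟ b′)

  flip-pair : ∀ {b b′ v} → Pair b b′ v → Pair b′ b (mate v)
  flip-pair (v∈ , sv , smv) = inside-mate v∈ , smv , trans (cong s (mate-involutive v∈)) sv

  apart : ∀ {b x y} → s x ≡ b → s y ≡ not b → s x ≢ s y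
  apart sx sy sx≡sy = Bool.not-¬ refl (trans (sym sx) (trans sx≡sy sy))

  square-across : ∀ {b b′ u w} → Pair b b′ u → Pair (not b) (not b′) w → w ≢ mate u → AlternatingSquare D
  square-across {u = u} {w} (u∈ , su , smu) (w∈ , sw , smw) w≢mu = record
    { u = u ; w = w ; inside-u = u∈ ; inside-w = w∈
    ; w≢u = λ w≡u → apart su sw (cong s (sym w≡u))
    ; w≢mate-u = w≢mu
    ; adj-u-w = cross (apart su sw)
    ; adj-mates = cross (apart smu smw)
    }

  square-across-parallel : ∀ {b u w} → Pair b b u → Pair (not b) (not b) w → AlternatingSquare D
  square-across-parallel u-bb w-bb =
    square-across u-bb w-bb (apart (proj₁ (proj₂ (flip-pair u-bb))) (proj₁ (proj₂ w-bb)) ∘ cong s ∘ sym)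

  -- other a and its partner are forced onto side b, so a, other a span a square
  unique-crossing : ∀ b {a} → Pair b (not b) a → (∀ {v} → Pair b (not b) v → v ≡ a) →
                    (∀ v → ¬ Pair (not b) (not b) v) → AlternatingSquare D
  unique-crossing b {a} (a∈ , _ , sma) unique no-opposite = record
    { u = a ; w = w ; inside-u = a∈ ; inside-w = w∈
    ; w≢u = λ w≡a → no-loop (subst (λ y → R a y ≡ true) w≡a (adj-other a∈))
    ; w≢mate-u = other≢mate a∈
    ; adj-u-w = adj-other a∈
    ; adj-mates = cross (apart smw sma ∘ sym)
    }
    where
    w = other a
    w∈ = inside-other a∈
    no-loop : R a a ≡ true → ⊥
    no-loop raa = contradiction (trans (sym raa) (R-irrefl a)) λ ()
    sw : s w ≡ b
    sw with ≡-or-≡not (s w) b | ≡-or-≡not (s (mate w)) b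
    ... | inj₁ sw≡b  | _           = sw≡b
    ... | inj₂ sw≡¬b | inj₂ smw≡¬b = contradiction (w∈ , sw≡¬b , smw≡¬b) (no-opposite w)
    ... | inj₂ sw≡¬b | inj₁ smw≡b  =
          contradiction (trans (sym (mate-involutive w∈)) (cong mate mw≡a)) (other≢mate a∈)
      where mw≡a = unique (flip-pair (w∈ , sw≡¬b , smw≡b))
    smw : s (mate w) ≡ b
    smw with ≡-or-≡not (s (mate w)) b
    ... | inj₁ smw≡b  = smw≡b
    ... | inj₂ smw≡¬b =
          ⊥-elim (no-loop (subst (λ y → R a y ≡ true) (unique (w∈ , sw , smw≡¬b)) (adj-other a∈)))

  -- Two crossing matching edges, or matching edges inside both sides, span a square; so does a
  -- unique crossing edge; otherwise all inside vertices are on one side.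
  square-or-one-side : AlternatingSquare D ⊎ ∃ λ b → ∀ {v} → inside v ≡ true → s v ≡ b
  square-or-one-side with find (pair? true false)
  ... | inj₁ (a , a-tf) with find (λ v → pair? true false v ×-dec ¬? (v Fin.≟ a))
  ...   | inj₁ (a′ , a′-tf , a′≢a) =
          inj₁ (square-across a-tf (flip-pair a′-tf) (a′≢a ∘ mate-injective (proj₁ a′-tf) (proj₁ a-tf)))
  ...   | inj₂ no-second with find (pair? false false)
  ...     | inj₂ no-ff = inj₁ (unique-crossing true a-tf unique no-ff)
    where
    unique : ∀ {v} → Pair true false v → v ≡ a
    unique {v} v-tf = decidable-stable (v Fin.≟ a) (λ v≢a → no-second v (v-tf , v≢a))
  ...     | inj₁ (y , y-ff) with find (pair? true true)
  ...       | inj₁ (x , x-tt) = inj₁ (square-across-parallel x-tt y-ff)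
  ...       | inj₂ no-tt = inj₁ (unique-crossing false (flip-pair a-tf) unique no-tt)
    where
    unique : ∀ {v} → Pair false true v → v ≡ mate a
    unique {v} v-ft = trans (sym (mate-involutive (proj₁ v-ft)))
      (cong mate (decidable-stable (mate v Fin.≟ a) (λ mv≢a → no-second (mate v) (flip-pair v-ft , mv≢a))))
  square-or-one-side | inj₂ no-tf with find (pair? true true) | find (pair? false false)
  ... | inj₁ (x , x-tt) | inj₁ (y , y-ff) = inj₁ (square-across-parallel x-tt y-ff)
  ... | inj₂ no-tt      | _               = inj₂ (false , λ {v} v∈ → Bool.¬-not λ sv → case-mate v v∈ sv)
    where
    case-mate : ∀ v → inside v ≡ true → s v ≡ true → ⊥
    case-mate v v∈ sv with ≡-or-≡not (s (mate v)) true
    ... | inj₁ smv = no-tt v (v∈ , sv , smv)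
    ... | inj₂ smv = no-tf v (v∈ , sv , smv)
  ... | inj₁ _          | inj₂ no-ff      = inj₂ (true , λ {v} v∈ → Bool.¬-not λ sv → case-mate v v∈ sv)
    where
    case-mate : ∀ v → inside v ≡ true → s v ≡ false → ⊥
    case-mate v v∈ sv with ≡-or-≡not (s (mate v)) false
    ... | inj₁ smv = no-ff v (v∈ , sv , smv)
    ... | inj₂ smv = no-tf (mate v) (flip-pair (v∈ , sv , smv))

-- Restricting a sub-matching to the image P of an embedding ι, where P is closed under inside
-- neighbours. π d v is the preimage of v ∈ P, and the junk value d outside P.
module Pullback {A N} {R′ : Fin A → Fin A → Bool} {R : Fin N → Fin N → Bool}
  (ι : Fin A → Fin N) (π : Fin A → Fin N → Fin A) (P : Fin N → Bool)
  (ι-π : ∀ d {v} → P v ≡ true → ι (π d v) ≡ v)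
  (π-ι : ∀ d i → π d (ι i) ≡ i)
  (P-ι : ∀ i → P (ι i) ≡ true)
  (R-ι : ∀ i j → R (ι i) (ι j) ≡ R′ i j)
  (D : SubMatching R) (O : SecondNeighbour D)
  (P-closed : ∀ {v w} → SubMatching.inside D v ≡ true → P v ≡ true →
              SubMatching.inside D w ≡ true → R v w ≡ true → P w ≡ true)
  where
  open SubMatching D
  open SecondNeighbour O

  ι-injective : ∀ {i j} → ι i ≡ ι j → i ≡ j
  ι-injective {i} {j} ιi≡ιj = trans (sym (π-ι i i)) (trans (cong (π i) ιi≡ιj) (π-ι i j))

  R-along : ∀ {i j v w} → ι i ≡ v → ι j ≡ w → R′ i j ≡ R v w
  R-along refl refl = sym (R-ι _ _)

  pull : ∀ i {v} → inside (ι i) ≡ true → inside v ≡ true → R (ι i) v ≡ true → ι (π i v) ≡ v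
  pull i i∈ v∈ edge = ι-π i (P-closed i∈ (P-ι i) v∈ edge)

  mate′ : Fin A → Fin A
  mate′ i = π i (mate (ι i))

  ι-mate : ∀ {i} → inside (ι i) ≡ true → ι (mate′ i) ≡ mate (ι i)
  ι-mate {i} i∈ = pull i i∈ (inside-mate i∈) (adj-mate i∈)

  inside-mate′ : ∀ {i} → inside (ι i) ≡ true → inside (ι (mate′ i)) ≡ true
  inside-mate′ i∈ = trans (cong inside (ι-mate i∈)) (inside-mate i∈)

  D′ : SubMatching R′
  D′ = record
    { inside          = inside ∘ ι
    ; mate            = mate′
    ; inside-mate     = inside-mate′
    ; mate-involutive = λ {i} i∈ → ι-injective
        (trans (ι-mate (inside-mate′ i∈)) (trans (cong mate (ι-mate i∈)) (mate-involutive i∈)))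
    ; adj-mate        = λ i∈ → trans (R-along refl (ι-mate i∈)) (adj-mate i∈)
    }

  O′ : SecondNeighbour D′
  O′ = record
    { other        = λ i → π i (other (ι i))
    ; inside-other = λ i∈ → trans (cong inside (ι-other i∈)) (inside-other i∈)
    ; adj-other    = λ i∈ → trans (R-along refl (ι-other i∈)) (adj-other i∈)
    ; other≢mate   = λ i∈ o≡m → other≢mate i∈
        (trans (sym (ι-other i∈)) (trans (cong ι o≡m) (ι-mate i∈)))
    }
    where
    ι-other : ∀ {i} → inside (ι i) ≡ true → ι (π i (other (ι i))) ≡ other (ι i)
    ι-other {i} i∈ = pull i i∈ (inside-other i∈) (adj-other i∈)

  push : AlternatingSquare D′ → AlternatingSquare D
  push sq = record
    { u = ι u ; w = ι w ; inside-u = inside-u ; inside-w = inside-w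
    ; w≢u       = w≢u ∘ ι-injective
    ; w≢mate-u  = λ ιw≡mιu → w≢mate-u (ι-injective (trans ιw≡mιu (sym (ι-mate inside-u))))
    ; adj-u-w   = trans (R-ι u w) adj-u-w
    ; adj-mates = trans (sym (R-along (ι-mate inside-u) (ι-mate inside-w))) adj-mates
    }
    where open AlternatingSquare sq

coAdj-sym : ∀ {N} (e : CoExpr N) u v → coAdj e u v ≡ coAdj e v u
coAdj-sym vertex u v = refl
coAdj-sym (union {a} e₁ e₂) u v with splitAt a u | splitAt a v
... | inj₁ i | inj₁ j = coAdj-sym e₁ i j
... | inj₂ i | inj₂ j = coAdj-sym e₂ i j
... | inj₁ _ | inj₂ _ = refl
... | inj₂ _ | inj₁ _ = refl
coAdj-sym (join {a} e₁ e₂) u v with splitAt a u | splitAt a v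
... | inj₁ i | inj₁ j = coAdj-sym e₁ i j
... | inj₂ i | inj₂ j = coAdj-sym e₂ i j
... | inj₁ _ | inj₂ _ = refl
... | inj₂ _ | inj₁ _ = refl

coAdj-irrefl : ∀ {N} (e : CoExpr N) v → coAdj e v v ≡ false
coAdj-irrefl vertex v = refl
coAdj-irrefl (union {a} e₁ e₂) v with splitAt a v
... | inj₁ i = coAdj-irrefl e₁ i
... | inj₂ i = coAdj-irrefl e₂ i
coAdj-irrefl (join {a} e₁ e₂) v with splitAt a v
... | inj₁ i = coAdj-irrefl e₁ i
... | inj₂ i = coAdj-irrefl e₂ i

coGraph : ∀ {N} → CoExpr N → Graph N
coGraph e = record { adj = coAdj e ; sym = coAdj-sym e ; irrefl = coAdj-irrefl e }

module Sides (a b : ℕ) where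
  isLeft : Fin (a + b) → Bool
  isLeft v = [ (λ _ → true) , (λ _ → false) ]′ (splitAt a v)

  fromLeft : Fin a → Fin (a + b) → Fin a
  fromLeft d v = [ (λ i → i) , (λ _ → d) ]′ (splitAt a v)

  fromRight : Fin b → Fin (a + b) → Fin b
  fromRight d v = [ (λ _ → d) , (λ j → j) ]′ (splitAt a v)

  ↑ˡ-fromLeft : ∀ d {v} → isLeft v ≡ true → fromLeft d v ↑ˡ b ≡ v
  ↑ˡ-fromLeft d {v} vL with splitAt a v in eq
  ... | inj₁ _ = Fin.splitAt⁻¹-↑ˡ eq

  ↑ʳ-fromRight : ∀ d {v} → not (isLeft v) ≡ true → a ↑ʳ fromRight d v ≡ v
  ↑ʳ-fromRight d {v} vR with splitAt a v in eq
  ... | inj₂ _ = Fin.splitAt⁻¹-↑ʳ eq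

  fromLeft-↑ˡ : ∀ d i → fromLeft d (i ↑ˡ b) ≡ i
  fromLeft-↑ˡ d i rewrite Fin.splitAt-↑ˡ a i b = refl

  fromRight-↑ʳ : ∀ d j → fromRight d (a ↑ʳ j) ≡ j
  fromRight-↑ʳ d j rewrite Fin.splitAt-↑ʳ a b j = refl

  isLeft-↑ˡ : ∀ i → isLeft (i ↑ˡ b) ≡ true
  isLeft-↑ˡ i rewrite Fin.splitAt-↑ˡ a i b = refl

  isRight-↑ʳ : ∀ j → not (isLeft (a ↑ʳ j)) ≡ true
  isRight-↑ʳ j rewrite Fin.splitAt-↑ʳ a b j = refl

  left-preimage : ∀ {v} → isLeft v ≡ true → ∃ λ i → i ↑ˡ b ≡ v
  left-preimage {v} vL with splitAt a v in eq
  ... | inj₁ i = i , Fin.splitAt⁻¹-↑ˡ eq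

  right-preimage : ∀ {v} → not (isLeft v) ≡ true → ∃ λ j → a ↑ʳ j ≡ v
  right-preimage {v} vR with splitAt a v in eq
  ... | inj₂ j = j , Fin.splitAt⁻¹-↑ʳ eq

  module _ (e₁ : CoExpr a) (e₂ : CoExpr b) where
    union-left : ∀ i j → coAdj (union e₁ e₂) (i ↑ˡ b) (j ↑ˡ b) ≡ coAdj e₁ i j
    union-left i j rewrite Fin.splitAt-↑ˡ a i b | Fin.splitAt-↑ˡ a j b = refl

    union-right : ∀ i j → coAdj (union e₁ e₂) (a ↑ʳ i) (a ↑ʳ j) ≡ coAdj e₂ i j
    union-right i j rewrite Fin.splitAt-↑ʳ a b i | Fin.splitAt-↑ʳ a b j = refl

    join-left : ∀ i j → coAdj (join e₁ e₂) (i ↑ˡ b) (j ↑ˡ b) ≡ coAdj e₁ i j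
    join-left i j rewrite Fin.splitAt-↑ˡ a i b | Fin.splitAt-↑ˡ a j b = refl

    join-right : ∀ i j → coAdj (join e₁ e₂) (a ↑ʳ i) (a ↑ʳ j) ≡ coAdj e₂ i j
    join-right i j rewrite Fin.splitAt-↑ʳ a b i | Fin.splitAt-↑ʳ a b j = refl

    union-same-side : ∀ {u w} → coAdj (union e₁ e₂) u w ≡ true → isLeft u ≡ isLeft w
    union-same-side {u} {w} uw with splitAt a u | splitAt a w
    ... | inj₁ _ | inj₁ _ = refl
    ... | inj₂ _ | inj₂ _ = refl

    join-cross : ∀ {u w} → isLeft u ≢ isLeft w → coAdj (join e₁ e₂) u w ≡ true
    join-cross {u} {w} different with splitAt a u | splitAt a w
    ... | inj₁ _ | inj₁ _ = contradiction refl different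
    ... | inj₂ _ | inj₂ _ = contradiction refl different
    ... | inj₁ _ | inj₂ _ = refl
    ... | inj₂ _ | inj₁ _ = refl

AlternatingSquares : ∀ {N} → (Fin N → Fin N → Bool) → Set
AlternatingSquares R =
  (D : SubMatching R) → SecondNeighbour D → ∀ {x} → SubMatching.inside D x ≡ true → AlternatingSquare D

module Halves {a b} (E : CoExpr (a + b)) (e₁ : CoExpr a) (e₂ : CoExpr b)
  (left-adj  : ∀ i j → coAdj E (i ↑ˡ b) (j ↑ˡ b) ≡ coAdj e₁ i j)
  (right-adj : ∀ i j → coAdj E (a ↑ʳ i) (a ↑ʳ j) ≡ coAdj e₂ i j)
  (squares₁ : AlternatingSquares (coAdj e₁)) (squares₂ : AlternatingSquares (coAdj e₂))
  (D : SubMatching (coAdj E)) (O : SecondNeighbour D) where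
  open SubMatching D
  open Sides a b

  ClosedSide : (Fin (a + b) → Bool) → Set
  ClosedSide P =
    ∀ {v w} → inside v ≡ true → P v ≡ true → inside w ≡ true → coAdj E v w ≡ true → P w ≡ true

  within-left : ClosedSide isLeft → ∀ {x} → inside x ≡ true → isLeft x ≡ true → AlternatingSquare D
  within-left closed x∈ xL with left-preimage xL
  ... | i , refl = L.push (squares₁ L.D′ L.O′ x∈)
    where
    module L = Pullback (_↑ˡ b) fromLeft isLeft ↑ˡ-fromLeft fromLeft-↑ˡ isLeft-↑ˡ left-adj D O closed

  within-right : ClosedSide (not ∘ isLeft) → ∀ {x} → inside x ≡ true → not (isLeft x) ≡ true →
                 AlternatingSquare D
  within-right closed x∈ xR with right-preimage xR
  ... | j , refl = R.push (squares₂ R.D′ R.O′ x∈)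
    where
    module R = Pullback (a ↑ʳ_) fromRight (not ∘ isLeft) ↑ʳ-fromRight fromRight-↑ʳ isRight-↑ʳ
                        right-adj D O closed

cograph-squares : ∀ {N} (e : CoExpr N) → AlternatingSquares (coAdj e)
cograph-squares vertex D O x∈ = contradiction (SubMatching.adj-mate D x∈) λ ()
cograph-squares (union {a} {b} e₁ e₂) D O {x} x∈ = by-side (isLeft x) refl
  where
  open Sides a b
  open Halves (union e₁ e₂) e₁ e₂ (union-left e₁ e₂) (union-right e₁ e₂)
              (cograph-squares e₁) (cograph-squares e₂) D O
  by-side : ∀ side → isLeft x ≡ side → AlternatingSquare D
  by-side true  xL = within-left (λ _ vL _ vw → trans (sym (union-same-side e₁ e₂ vw)) vL) x∈ xL
  by-side false xR = within-right (λ _ vR _ vw → trans (cong not (sym (union-same-side e₁ e₂ vw))) vR)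
                       x∈ (cong not xR)
cograph-squares (join {a} {b} e₁ e₂) D O {x} x∈ =
  by-sides (JoinSides.square-or-one-side (coAdj-irrefl (join e₁ e₂)) D O isLeft (join-cross e₁ e₂))
  where
  open SubMatching D
  open Sides a b
  open Halves (join e₁ e₂) e₁ e₂ (join-left e₁ e₂) (join-right e₁ e₂)
              (cograph-squares e₁) (cograph-squares e₂) D O
  by-sides : AlternatingSquare D ⊎ ∃ (λ side → ∀ {v} → inside v ≡ true → isLeft v ≡ side) →
             AlternatingSquare D
  by-sides (inj₁ square)          = square
  by-sides (inj₂ (true  , left))  = within-left (λ _ _ w∈ _ → left w∈) x∈ (left x∈)
  by-sides (inj₂ (false , right)) = within-right (λ _ _ w∈ _ → cong not (right w∈)) x∈ (cong not (right x∈))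

cograph⇒alternatingCycle : ∀ {n} (G : Graph n) → IsCograph G → (D : SubMatching (adj G)) →
  SecondNeighbour D → ∀ {x₀} → SubMatching.inside D x₀ ≡ true → AlternatingCycle D
cograph⇒alternatingCycle G (e , σ , G≅e) D O x₀∈ =
  square⇒cycle G D (I.push (cograph-squares e I.D′ I.O′ x₀∈′))
  where
  open SubMatching D
  G-from : ∀ i j → adj G (σ ⟨$⟩ˡ i) (σ ⟨$⟩ˡ j) ≡ coAdj e i j
  G-from i j = trans (G≅e _ _) (cong₂ (coAdj e) (inverseʳ σ) (inverseʳ σ))
  module I = Pullback (σ ⟨$⟩ˡ_) (λ _ → σ ⟨$⟩ʳ_) (λ _ → true) (λ _ _ → inverseˡ σ) (λ _ _ → inverseʳ σ)
                      (λ _ → refl) G-from D O (λ _ _ _ _ → refl)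
  x₀∈′ = subst (λ v → inside v ≡ true) (sym (inverseˡ σ)) x₀∈

-- The lower bound

∧-≡-true : ∀ {x y} → x ∧ y ≡ true → x ≡ true × y ≡ true
∧-≡-true {true} {true} refl = refl , refl

module _ {n} {G : Graph n} (M : PerfectMatching G) (S : EdgeSubset M) where

  HasDetour : Fin n → Set
  HasDetour v = ∃ λ w → adj G v w ≡ true × not (covered S w) ≡ true × w ≢ partner M v

  hasDetour? : Decidable HasDetour
  hasDetour? v = Fin.any? λ w →
    (adj G v w Bool.≟ true) ×-dec (not (covered S w) Bool.≟ true) ×-dec ¬? (w Fin.≟ partner M v)

  degree-without-detour : ∀ v → ¬ HasDetour v → degree G v ≤ 2 * size S + 1
  degree-without-detour v no-detour = begin
    degree G v
      ≡⟨ countTrue-split (adj G v) (covered S) ⟩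
    countTrue (λ w → adj G v w ∧ covered S w) + countTrue (λ w → adj G v w ∧ not (covered S w))
      ≤⟨ +-mono-≤ covered-neighbours uncovered-neighbours ⟩
    countTrue (covered S) + 1
      ≡⟨ cong (_+ 1) (countTrue-covered S) ⟩
    2 * size S + 1
      ∎
    where
    open ≤-Reasoning
    covered-neighbours = countTrue-mono _ (covered S) (λ w → proj₂ ∘ ∧-≡-true)
    uncovered-neighbours = countTrue-≤1 _ (partner M v) λ w vw∧uncovered →
      let vw , w-uncovered = ∧-≡-true vw∧uncovered
      in decidable-stable (w Fin.≟ partner M v) (λ w≢mv → no-detour (w , vw , w-uncovered , w≢mv))

  secondNeighbour : (∀ v → HasDetour v) → SecondNeighbour (uncovered M S)
  secondNeighbour detour = record
    { other        = proj₁ ∘ detour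
    ; inside-other = λ {v} _ → proj₁ (proj₂ (proj₂ (detour v)))
    ; adj-other    = λ {v} _ → proj₁ (proj₂ (detour v))
    ; other≢mate   = λ {v} _ → proj₂ (proj₂ (proj₂ (detour v)))
    }

forcing⇒δ≤ : ∀ {n} (G : Graph n) → IsSplit G ⊎ IsCograph G →
  (M : PerfectMatching G) (S : EdgeSubset M) → IsForcing M S → δ G ≤ 2 * size S + 1
forcing⇒δ≤ {zero}  G _ M S _ = z≤n
forcing⇒δ≤ {suc n} G split⊎cograph M S forcing with find (¬? ∘ hasDetour? M S)
... | inj₁ (v , no-detour) = ≤-trans (minOver-≤ (degree G) v) (degree-without-detour M S v no-detour)
... | inj₂ all-detour = contradiction forcing (alternatingCycle⇒¬forcing M S cycle)
  where
  detour : ∀ v → HasDetour M S v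
  detour v = decidable-stable (hasDetour? M S v) (all-detour v)
  O = secondNeighbour M S detour
  x₀∈ = proj₁ (proj₂ (proj₂ (detour zero)))
  cycle = [ (λ split → SplitCycle.alternatingCycle G split (uncovered M S) O x₀∈)
          , (λ cograph → cograph⇒alternatingCycle G cograph (uncovered M S) O x₀∈) ]′ split⊎cograph

-- Extremal graphs

data Threshold : ∀ {N} → CoExpr N → Set where
  single     : Threshold vertex
  dominating : ∀ {N} {e : CoExpr N} → Threshold e → Threshold (join vertex e)
  isolated   : ∀ {N} {e : CoExpr N} → Threshold e → Threshold (union vertex e)

-- dominating vertices join the clique, isolated ones the independent set
threshold⇒split : ∀ {N} {e : CoExpr N} → Threshold e → IsSplit (coGraph e)
threshold⇒split single = (λ _ → false) , (λ _ _ ()) , (λ _ _ _ _ → refl)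
threshold⇒split (dominating t) with threshold⇒split t
... | c , complete , independent = (true ∷ c) , complete′ , independent′
  where
  complete′ : ∀ u v → (true ∷ c) u ≡ true → (true ∷ c) v ≡ true → u ≢ v → coAdj (join vertex _) u v ≡ true
  complete′ zero    zero    _  _  u≢v = contradiction refl u≢v
  complete′ zero    (suc j) _  _  _   = refl
  complete′ (suc i) zero    _  _  _   = refl
  complete′ (suc i) (suc j) ci cj u≢v = complete i j ci cj (u≢v ∘ cong suc)
  independent′ : ∀ u v → (true ∷ c) u ≡ false → (true ∷ c) v ≡ false → coAdj (join vertex _) u v ≡ false
  independent′ (suc i) (suc j) ci cj = independent i j ci cj
threshold⇒split (isolated t) with threshold⇒split t
... | c , complete , independent = (false ∷ c) , complete′ , independent′
  where
  complete′ : ∀ u v → (false ∷ c) u ≡ true → (false ∷ c) v ≡ true → u ≢ v → coAdj (union vertex _) u v ≡ true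
  complete′ (suc i) (suc j) ci cj u≢v = complete i j ci cj (u≢v ∘ cong suc)
  independent′ : ∀ u v → (false ∷ c) u ≡ false → (false ∷ c) v ≡ false → coAdj (union vertex _) u v ≡ false
  independent′ zero    zero    _  _  = refl
  independent′ zero    (suc j) _  _  = refl
  independent′ (suc i) zero    _  _  = refl
  independent′ (suc i) (suc j) ci cj = independent i j ci cj

pairs : ℕ → ℕ
pairs zero    = zero
pairs (suc n) = suc (suc (pairs n))

pairs≡2* : ∀ n → pairs n ≡ 2 * n
pairs≡2* zero    = refl
pairs≡2* (suc n) = trans (cong (λ x → suc (suc x)) (pairs≡2* n)) (sym (*-suc 2 n))

pairs-mono : ∀ {m n} → m ≤ n → pairs m ≤ pairs n
pairs-mono z≤n       = z≤n
pairs-mono (s≤s m≤n) = s≤s (s≤s (pairs-mono m≤n))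

pendantPair universalPair : ∀ {N} → CoExpr N → CoExpr (2 + N)
pendantPair   e = join vertex (union vertex e)
universalPair e = join vertex (join vertex e)

tower : (k j : ℕ) → CoExpr (pairs (suc (k + j)))
tower zero    zero    = join vertex vertex
tower zero    (suc j) = pendantPair (tower zero j)
tower (suc k) j       = universalPair (tower k j)

tower-threshold : ∀ k j → Threshold (tower k j)
tower-threshold zero    zero    = dominating single
tower-threshold zero    (suc j) = dominating (isolated (tower-threshold zero j))
tower-threshold (suc k) j       = dominating (dominating (tower-threshold k j))

IsPairing : ∀ {N} → (Fin N → Fin N → Bool) → (Fin N → Fin N) → Set
IsPairing R p = (∀ v → p (p v) ≡ v) × (∀ v → R v (p v) ≡ true)

pairHead : ∀ {N} → (Fin N → Fin N) → Fin (2 + N) → Fin (2 + N)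
pairHead p zero          = suc zero
pairHead p (suc zero)    = zero
pairHead p (suc (suc i)) = suc (suc (p i))

module _ {N} (R : Fin (2 + N) → Fin (2 + N) → Bool) {R′ : Fin N → Fin N → Bool}
  (R-tail : ∀ i j → R (suc (suc i)) (suc (suc j)) ≡ R′ i j) where

  pairHead-isPairing : R zero (suc zero) ≡ true → R (suc zero) zero ≡ true →
                       ∀ {p} → IsPairing R′ p → IsPairing R (pairHead p)
  pairHead-isPairing R01 R10 {p} (p-inv , p-adj) = involutive′ , adj′
    where
    involutive′ : ∀ v → pairHead p (pairHead p v) ≡ v
    involutive′ zero          = refl
    involutive′ (suc zero)    = refl
    involutive′ (suc (suc i)) = cong (λ x → suc (suc x)) (p-inv i)
    adj′ : ∀ v → R v (pairHead p v) ≡ true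
    adj′ zero          = R01
    adj′ (suc zero)    = R10
    adj′ (suc (suc i)) = trans (R-tail i (p i)) (p-adj i)

  pairHead-tail : ∀ {q} → IsPairing R q → q zero ≡ suc zero →
                  ∃ λ q′ → IsPairing R′ q′ × (∀ v → q v ≡ pairHead q′ v)
  pairHead-tail {q} (q-inv , q-adj) q0 = q′ , (q′-inv , q′-adj) , q≡pairHead
    where
    q1 : q (suc zero) ≡ zero
    q1 = trans (cong q (sym q0)) (q-inv zero)
    q-shifted : ∀ i → ∃ λ j → q (suc (suc i)) ≡ suc (suc j)
    q-shifted i with q (suc (suc i)) in eq
    ... | zero          = contradiction (trans (sym (q-inv _)) (trans (cong q eq) q0)) λ ()
    ... | suc zero      = contradiction (trans (sym (q-inv _)) (trans (cong q eq) q1)) λ ()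
    ... | suc (suc j)   = j , refl
    q′ : Fin N → Fin N
    q′ i = proj₁ (q-shifted i)
    q≡pairHead : ∀ v → q v ≡ pairHead q′ v
    q≡pairHead zero          = q0
    q≡pairHead (suc zero)    = q1
    q≡pairHead (suc (suc i)) = proj₂ (q-shifted i)
    q′-inv : ∀ i → q′ (q′ i) ≡ i
    q′-inv i = Fin.suc-injective (Fin.suc-injective (begin
      suc (suc (q′ (q′ i)))       ≡⟨ q≡pairHead (suc (suc (q′ i))) ⟨
      q (suc (suc (q′ i)))        ≡⟨ cong q (q≡pairHead (suc (suc i))) ⟨
      q (q (suc (suc i)))         ≡⟨ q-inv (suc (suc i)) ⟩
      suc (suc i)                 ∎))
      where open ≡-Reasoning
    q′-adj : ∀ i → R′ i (q′ i) ≡ true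
    q′-adj i =
      trans (sym (R-tail i (q′ i))) (trans (cong (R (suc (suc i))) (sym (proj₂ (q-shifted i)))) (q-adj _))

  pairHead-unique : ∀ {p q} → IsPairing R q → q zero ≡ suc zero →
    (∀ {q′} → IsPairing R′ q′ → (∀ i → q (suc (suc i)) ≡ suc (suc (q′ i))) → ∀ i → p i ≡ q′ i) →
    ∀ v → pairHead p v ≡ q v
  pairHead-unique {p} {q} q-pairing q0 tail-unique v with pairHead-tail q-pairing q0
  ... | q′ , q′-pairing , q≡pairHead = trans (by-cases v) (sym (q≡pairHead v))
    where
    p≡q′ = tail-unique q′-pairing (λ i → q≡pairHead (suc (suc i)))
    by-cases : ∀ v → pairHead p v ≡ pairHead q′ v
    by-cases zero          = refl
    by-cases (suc zero)    = refl
    by-cases (suc (suc i)) = cong (λ x → suc (suc x)) (p≡q′ i)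

towerPairing : ∀ k j → Fin (pairs (suc (k + j))) → Fin (pairs (suc (k + j)))
towerPairing zero    zero    = pairHead (λ ())
towerPairing zero    (suc j) = pairHead (towerPairing zero j)
towerPairing (suc k) j       = pairHead (towerPairing k j)

towerPairing-isPairing : ∀ k j → IsPairing (coAdj (tower k j)) (towerPairing k j)
towerPairing-isPairing zero    zero    =
  pairHead-isPairing (coAdj (tower zero zero)) {λ ()} (λ ()) refl refl ((λ ()) , (λ ()))
towerPairing-isPairing zero    (suc j) =
  pairHead-isPairing (coAdj (tower zero (suc j))) (λ _ _ → refl) refl refl (towerPairing-isPairing zero j)
towerPairing-isPairing (suc k) j       =
  pairHead-isPairing (coAdj (tower (suc k) j)) (λ _ _ → refl) refl refl (towerPairing-isPairing k j)

towerCover : ∀ k j → Fin (pairs (suc (k + j))) → Bool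
towerCover zero    j = λ _ → false
towerCover (suc k) j = true ∷ true ∷ towerCover k j

towerCover-closed : ∀ k j v → towerCover k j (towerPairing k j v) ≡ towerCover k j v
towerCover-closed zero    j v             = refl
towerCover-closed (suc k) j zero          = refl
towerCover-closed (suc k) j (suc zero)    = refl
towerCover-closed (suc k) j (suc (suc i)) = towerCover-closed k j i

towerCover-pairs : ∀ k j → ⌊ countTrue (towerCover k j) /2⌋ ≡ k
towerCover-pairs zero    j = cong ⌊_/2⌋ (countTrue-none (towerCover zero j) (λ _ → refl))
towerCover-pairs (suc k) j = cong suc (towerCover-pairs k j)

-- Below the universal pairs every vertex of the tower has only one possible partner.
towerPairing-forced : ∀ k j {q} → IsPairing (coAdj (tower k j)) q →
  (∀ v → towerCover k j v ≡ true → q v ≡ towerPairing k j v) → ∀ v → towerPairing k j v ≡ q v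
towerPairing-forced zero zero {q} q-pairing _ =
  pairHead-unique (coAdj (tower zero zero)) {λ ()} (λ ()) q-pairing q0 (λ _ _ ())
  where
  q0 : q zero ≡ suc zero
  q0 with q zero in eq
  ... | zero     = contradiction (trans (cong (coAdj (tower zero zero) zero) (sym eq)) (proj₂ q-pairing zero)) λ ()
  ... | suc zero = refl
towerPairing-forced zero (suc j) {q} q-pairing _ =
  pairHead-unique (coAdj (tower zero (suc j))) (λ _ _ → refl) q-pairing
    (trans (cong q (sym q1)) (proj₁ q-pairing (suc zero)))
    (λ q′-pairing _ → towerPairing-forced zero j q′-pairing λ _ ())
  where
  non-neighbour : ∀ {y} → q (suc zero) ≡ y → coAdj (tower zero (suc j)) (suc zero) y ≡ false → ⊥
  non-neighbour eq non-adjacent = contradiction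
    (trans (sym non-adjacent)
           (trans (cong (coAdj (tower zero (suc j)) (suc zero)) (sym eq)) (proj₂ q-pairing (suc zero))))
    λ ()
  -- the second vertex of a pendant pair has no other neighbour
  q1 : q (suc zero) ≡ zero
  q1 with q (suc zero) in eq
  ... | zero        = refl
  ... | suc zero    = ⊥-elim (non-neighbour eq refl)
  ... | suc (suc i) = ⊥-elim (non-neighbour eq refl)
towerPairing-forced (suc k) j {q} q-pairing cover-forced =
  pairHead-unique (coAdj (tower (suc k) j)) (λ _ _ → refl) q-pairing (cover-forced zero refl)
    λ {q′} q′-pairing q≡q′ → towerPairing-forced k j q′-pairing λ i i-covered →
      Fin.suc-injective (Fin.suc-injective (trans (sym (q≡q′ i)) (cover-forced (suc (suc i)) i-covered)))

tower-fAtMost : ∀ k j → fAtMost (coGraph (tower k j)) k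
tower-fAtMost k j = M₀ , S₀ , forcing , ≤-reflexive (towerCover-pairs k j)
  where
  pairing = towerPairing-isPairing k j
  M₀ : PerfectMatching (coGraph (tower k j))
  M₀ = record
    { partner    = towerPairing k j
    ; involutive = proj₁ pairing
    ; noFix      = λ v → adj-≢ (coGraph (tower k j)) (proj₂ pairing v) ∘ sym
    ; isEdge     = proj₂ pairing
    }
  S₀ : EdgeSubset M₀
  S₀ = record { covered = towerCover k j ; closed = towerCover-closed k j }
  forcing : IsForcing M₀ S₀
  forcing M agrees = towerPairing-forced k j (involutive M , isEdge M) agrees

towerDegree : ∀ k j → Fin (pairs (suc (k + j))) → ℕ
towerDegree k j = degree (coGraph (tower k j))

towerDegree-≥ : ∀ k j v → suc (pairs k) ≤ towerDegree k j v
towerDegree-≥ zero    j v = countTrue-pos (coAdj (tower zero j) v) (proj₂ (towerPairing-isPairing zero j) v)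
towerDegree-≥ (suc k) j zero =
  ≤-trans (s≤s (s≤s (s≤s (pairs-mono (m≤m+n k j))))) (≤-reflexive (sym (countTrue-all _)))
towerDegree-≥ (suc k) j (suc zero) =
  ≤-trans (s≤s (s≤s (s≤s (pairs-mono (m≤m+n k j))))) (≤-reflexive (cong suc (sym (countTrue-all _))))
towerDegree-≥ (suc k) j (suc (suc i)) = s≤s (s≤s (towerDegree-≥ k j i))

towerDegree-attained : ∀ k j → ∃ λ v → towerDegree k j v ≡ suc (pairs k)
towerDegree-attained zero    zero    = zero , refl
towerDegree-attained zero    (suc j) =
  suc zero , cong suc (countTrue-none (λ i → coAdj (tower zero (suc j)) (suc zero) (suc (suc i))) (λ _ → refl))
towerDegree-attained (suc k) j with towerDegree-attained k j
... | v , deg≡ = suc (suc v) , cong (λ d → suc (suc d)) deg≡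

tower-δ : ∀ k j → δ (coGraph (tower k j)) ≡ 2 * k + 1
tower-δ k j with towerDegree-attained k j
... | v , deg≡ = begin
  δ (coGraph (tower k j)) ≡⟨ δ-attained (coGraph (tower k j)) v deg≡ (towerDegree-≥ k j) ⟩
  suc (pairs k)           ≡⟨ cong suc (pairs≡2* k) ⟩
  1 + 2 * k               ≡⟨ +-comm 1 (2 * k) ⟩
  2 * k + 1               ∎
  where open ≡-Reasoning

fAtLeast-from-δ : ∀ {n} (G : Graph n) {k} → IsSplit G ⊎ IsCograph G → δ G ≡ 2 * k + 1 → fAtLeast G k
fAtLeast-from-δ G split⊎cograph δ≡ M S forcing =
  *-cancelˡ-≤ 2 (+-cancelʳ-≤ 1 _ _ (subst (_≤ 2 * size S + 1) δ≡ (forcing⇒δ≤ G split⊎cograph M S forcing)))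

Extremal : ℕ → ℕ → Set
Extremal N k = Σ (Graph N) λ G → IsSplit G × IsCograph G × δ G ≡ 2 * k + 1 × fEquals G k

tower-extremal : ∀ k j → Extremal (pairs (suc (k + j))) k
tower-extremal k j = coGraph (tower k j) , split , cograph , tower-δ k j ,
                     fAtLeast-from-δ (coGraph (tower k j)) (inj₁ split) (tower-δ k j) , tower-fAtMost k j
  where
  split = threshold⇒split (tower-threshold k j)
  cograph : IsCograph (coGraph (tower k j))
  cograph = tower k j , Perm.id , λ _ _ → refl

extremal : ∀ n k → k < n → Extremal (2 * n) k
extremal (suc n) k (s≤s k≤n) = subst (λ N → Extremal N k) size≡ (tower-extremal k (n ∸ k))
  where
  size≡ : pairs (suc (k + (n ∸ k))) ≡ 2 * suc n
  size≡ = trans (cong (pairs ∘ suc) (m+[n∸m]≡n k≤n)) (pairs≡2* (suc n))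

theorem2p8 :
    ((n : ℕ) (G : Graph n) → IsSplit G ⊎ IsCograph G →
      (M : PerfectMatching G) (S : EdgeSubset M) → IsForcing M S →
      δ G ≤ 2 * size S + 1)
    ×
    ((n k : ℕ) → k < n →
      (Σ (Graph (2 * n)) λ G → IsSplit G × δ G ≡ 2 * k + 1 × fEquals G k)
      ×
      (Σ (Graph (2 * n)) λ G → IsCograph G × δ G ≡ 2 * k + 1 × fEquals G k))
theorem2p8 = (λ _ → forcing⇒δ≤) , λ n k k<n →
  let G , split , cograph , δ≡ , f≡ = extremal n k k<n
  in (G , split , δ≡ , f≡) , (G , cograph , δ≡ , f≡)
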